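{- Let $V = \{v_1,\dots,v_n\}$ be a finite set. The map $I$, sending each astral $\hat{G} \neq K_n$ on $V$ to its unique maximum-size independent set $I(\hat{G}) \subseteq V$, is injective.
   Context: All graphs are simple undirected graphs on the vertex set $V$; $K_n$ is the complete graph on $V$. For a graph $\hat{G} = (V,\hat{E})$ and $v \in V$, let $\hat{G} \setminus v = (V, \hat{E} \cup \{\{v,u\} : u \in V, u \neq v\})$. Astrals are defined recursively: the edgeless graph $(V,\emptyset)$ is an astral; if $\hat{G} \neq K_n$ is an astral and $v \in I(\hat{G})$, then $\hat{G} \setminus v$ is an astral. Here, for an astral $\hat{G} \neq K_n$, $I(\hat{G})$ denotes its unique maximum-size independent set (every astral other than $K_n$ has a unique maximal independent set of size $\geq 2$, it is maximum, and the astral is the union of stars centered at the vertices of $V \setminus I(\hat{G})$). -}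

module Defs where

open import Data.Nat using (ℕ; _≤_)
open import Data.Bool using (Bool; true; false; _∨_; _∧_; not)
open import Data.Fin using (Fin; _≟_)
open import Data.Fin.Subset using (Subset; _∈_; ∣_∣)
open import Data.Product using (Σ; _×_)
open import Relation.Nullary using (¬_)
open import Relation.Nullary.Decidable using (⌊_⌋)
open import Relation.Binary.PropositionalEquality using (_≡_; _≢_)

-- A graph on the vertex set V = Fin n, given by its adjacency function.
-- (Simple: all graphs arising below are symmetric and loopless.)
Graph : ℕ → Set
Graph n = Fin n → Fin n → Bool

_≈G_ : ∀ {n} → Graph n → Graph n → Set
G ≈G H = ∀ u w → G u w ≡ H u w

edgeless : ∀ {n} → Graph n
edgeless _ _ = false

IsComplete : ∀ {n} → Graph n → Set
IsComplete G = ∀ u w → u ≢ w → G u w ≡ true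

_∖ᵍ_ : ∀ {n} → Graph n → Fin n → Graph n
(G ∖ᵍ v) u w = G u w
             ∨ (⌊ u ≟ v ⌋ ∧ not ⌊ w ≟ v ⌋)
             ∨ (⌊ w ≟ v ⌋ ∧ not ⌊ u ≟ v ⌋)

Independent : ∀ {n} → Graph n → Subset n → Set
Independent G S = ∀ u w → u ∈ S → w ∈ S → G u w ≡ false

MaxIndependent : ∀ {n} → Graph n → Subset n → Set
MaxIndependent G S = Independent G S × (∀ T → Independent G T → ∣ T ∣ ≤ ∣ S ∣)

-- For an astral Ĝ ≠ K_n, I(Ĝ) is its unique
-- maximum independent set; "v ∈ I(Ĝ)" is rendered as "v lies in a maximum
-- independent set S of Ĝ" (equivalent by that uniqueness).
data Astral {n : ℕ} : Graph n → Set where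
  astral-edgeless : Astral edgeless
  astral-step     : ∀ {G} (v : Fin n) (S : Subset n) →
                    Astral G → ¬ IsComplete G →
                    MaxIndependent G S → v ∈ S →
                    Astral (G ∖ᵍ v)

module Submission where

-- Every astral is a *star union*: there is a set C of centres such that
-- the edges are exactly the pairs of distinct vertices meeting C (the edgeless
-- graph has C = ∅, and Ĝ ∖ v has centres C ∪ {v}).  A star union is determined
-- by its centre set.  If a star union Ĝ is not complete, its maximum
-- independent set is forced to be V ∖ C: the non-centres are independent, so a
-- maximum independent set S has at least |V ∖ C| elements; a centre in S would
-- be adjacent to every other vertex, forcing |V ∖ C| ≤ |S| ≤ 1 and hence
-- Ĝ = K_n; so S ⊆ V ∖ C, and the cardinality bound gives S = V ∖ C.
-- Consequently two non-complete astrals with a common maximum independent set S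
-- both have centre set V ∖ S, and so they coincide.

open import Defs
open import Data.Nat using (ℕ; _≤_; _<_)
open import Data.Nat.Properties using (≤-trans; <⇒≱)
open import Data.Fin using (Fin) renaming (_≟_ to _≟F_)
open import Data.Fin.Subset using (Subset; _∈_; _∉_; ∣_∣; _∪_; ⁅_⁆; ∁; _⊆_; ⊥)
open import Data.Fin.Subset.Properties
open import Data.Bool using (true; false)
open import Data.Bool.Properties using (∨-zeroʳ; ∨-identityʳ)
open import Data.Product using (Σ; _,_; proj₁; proj₂)
open import Data.Sum using (_⊎_; inj₁; inj₂)
open import Relation.Nullary using (¬_; yes; no; contradiction)
open import Relation.Nullary.Decidable using (Dec; ⌊_⌋; isYes≗does; dec-true; dec-false)
open import Relation.Binary.PropositionalEquality
  using (_≡_; _≢_; refl; sym; trans; subst)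
open import Function using (_∘_)

⌊⌋-true : ∀ {a} {A : Set a} (a? : Dec A) → A → ⌊ a? ⌋ ≡ true
⌊⌋-true a? a = trans (isYes≗does a?) (dec-true a? a)

⌊⌋-false : ∀ {a} {A : Set a} (a? : Dec A) → ¬ A → ⌊ a? ⌋ ≡ false
⌊⌋-false a? ¬a = trans (isYes≗does a?) (dec-false a? ¬a)

two-members : ∀ {n} {p : Subset n} {u w : Fin n} →
              u ∈ p → w ∈ p → u ≢ w → 2 ≤ ∣ p ∣
two-members {p = p} {u} {w} u∈p w∈p u≢w =
  subst (_< ∣ p ∣) (∣⁅x⁆∣≡1 u)
        (p⊂q⇒∣p∣<∣q∣ (⁅u⁆⊆p , w , w∈p , x≢y⇒x∉⁅y⁆ (u≢w ∘ sym)))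
  where
  ⁅u⁆⊆p : ⁅ u ⁆ ⊆ p
  ⁅u⁆⊆p x∈⁅u⁆ = subst (_∈ p) (sym (x∈⁅y⁆⇒x≡y u x∈⁅u⁆)) u∈p

⊆-of-full-size : ∀ {n} {p q : Subset n} → p ⊆ q → ∣ q ∣ ≤ ∣ p ∣ → p ≡ q
⊆-of-full-size {p = p} {q} p⊆q ∣q∣≤∣p∣ = ⊆-antisym p⊆q q⊆p
  where
  q⊆p : q ⊆ p
  q⊆p {x} x∈q with x ∈? p
  ... | yes x∈p = x∈p
  ... | no  x∉p = contradiction ∣q∣≤∣p∣ (<⇒≱ (p⊂q⇒∣p∣<∣q∣ (p⊆q , x , x∈q , x∉p)))

∁-injective : ∀ {n} {p q : Subset n} → ∁ p ≡ ∁ q → p ≡ q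
∁-injective {p = p} {q} ∁p≡∁q =
  ⊆-antisym (∁p⊆∁q⇒p⊇q (subst (∁ q ⊆_) (sym ∁p≡∁q) ⊆-refl))
            (∁p⊆∁q⇒p⊇q (subst (∁ p ⊆_) ∁p≡∁q ⊆-refl))

module _ {n : ℕ} (G : Graph n) (v : Fin n) where

  ∖ᵍ-keeps : ∀ {u w} → G u w ≡ true → (G ∖ᵍ v) u w ≡ true
  ∖ᵍ-keeps G-uw rewrite G-uw = refl

  ∖ᵍ-joins : ∀ {u w} → u ≢ w → u ≡ v ⊎ w ≡ v → (G ∖ᵍ v) u w ≡ true
  ∖ᵍ-joins {u} {w} u≢w (inj₁ refl)
    rewrite ⌊⌋-true (u ≟F u) refl | ⌊⌋-false (w ≟F u) (u≢w ∘ sym) =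
    ∨-zeroʳ (G u w)
  ∖ᵍ-joins {u} {w} u≢w (inj₂ refl)
    rewrite ⌊⌋-true (w ≟F w) refl | ⌊⌋-false (u ≟F w) u≢w =
    ∨-zeroʳ (G u w)

  ∖ᵍ-away : ∀ {u w} → u ≢ v → w ≢ v → (G ∖ᵍ v) u w ≡ G u w
  ∖ᵍ-away {u} {w} u≢v w≢v
    rewrite ⌊⌋-false (u ≟F v) u≢v | ⌊⌋-false (w ≟F v) w≢v =
    ∨-identityʳ (G u w)

  ∖ᵍ-loop : ∀ u → (G ∖ᵍ v) u u ≡ G u u
  ∖ᵍ-loop u with u ≟F v
  ... | yes _ = ∨-identityʳ (G u u)
  ... | no  _ = ∨-identityʳ (G u u)

record StarUnion {n : ℕ} (G : Graph n) (C : Subset n) : Set where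
  field
    loopless : ∀ u → G u u ≡ false
    spoke    : ∀ {u w} → u ∈ C ⊎ w ∈ C → u ≢ w → G u w ≡ true
    free     : ∀ {u w} → u ∉ C → w ∉ C → G u w ≡ false
open StarUnion

edgeless-starUnion : ∀ {n} → StarUnion (edgeless {n}) ⊥
edgeless-starUnion .loopless _         = refl
edgeless-starUnion .spoke (inj₁ u∈⊥) _ = contradiction u∈⊥ ∉⊥
edgeless-starUnion .spoke (inj₂ w∈⊥) _ = contradiction w∈⊥ ∉⊥
edgeless-starUnion .free _ _           = refl

∖ᵍ-starUnion : ∀ {n} {G : Graph n} {C} v →
               StarUnion G C → StarUnion (G ∖ᵍ v) (C ∪ ⁅ v ⁆)
∖ᵍ-starUnion {G = G} v U .loopless u = trans (∖ᵍ-loop G v u) (loopless U u)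
∖ᵍ-starUnion {G = G} {C} v U .spoke (inj₁ u∈) u≢w with x∈p∪q⁻ C ⁅ v ⁆ u∈
... | inj₁ u∈C  = ∖ᵍ-keeps G v (spoke U (inj₁ u∈C) u≢w)
... | inj₂ u∈⁅v⁆ = ∖ᵍ-joins G v u≢w (inj₁ (x∈⁅y⁆⇒x≡y v u∈⁅v⁆))
∖ᵍ-starUnion {G = G} {C} v U .spoke (inj₂ w∈) u≢w with x∈p∪q⁻ C ⁅ v ⁆ w∈
... | inj₁ w∈C  = ∖ᵍ-keeps G v (spoke U (inj₂ w∈C) u≢w)
... | inj₂ w∈⁅v⁆ = ∖ᵍ-joins G v u≢w (inj₂ (x∈⁅y⁆⇒x≡y v w∈⁅v⁆))
∖ᵍ-starUnion {G = G} {C} v U .free u∉ w∉ =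
  trans (∖ᵍ-away G v (u∉ ∘ new-centre) (w∉ ∘ new-centre))
        (free U (u∉ ∘ p⊆p∪q ⁅ v ⁆) (w∉ ∘ p⊆p∪q ⁅ v ⁆))
  where
  new-centre : ∀ {x} → x ≡ v → x ∈ C ∪ ⁅ v ⁆
  new-centre refl = q⊆p∪q C ⁅ v ⁆ (x∈⁅x⁆ v)

astral-starUnion : ∀ {n} {G : Graph n} → Astral G → Σ (Subset n) (StarUnion G)
astral-starUnion astral-edgeless = ⊥ , edgeless-starUnion
astral-starUnion (astral-step v _ A _ _ _) with astral-starUnion A
... | C , U = C ∪ ⁅ v ⁆ , ∖ᵍ-starUnion v U

starUnion-unique : ∀ {n} {G H : Graph n} {C} →
                   StarUnion G C → StarUnion H C → G ≈G H
starUnion-unique {C = C} UG UH u w with u ≟F w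
... | yes refl = trans (loopless UG u) (sym (loopless UH u))
... | no u≢w with u ∈? C | w ∈? C
...   | yes u∈C | _      = trans (spoke UG (inj₁ u∈C) u≢w) (sym (spoke UH (inj₁ u∈C) u≢w))
...   | no _    | yes w∈C = trans (spoke UG (inj₂ w∈C) u≢w) (sym (spoke UH (inj₂ w∈C) u≢w))
...   | no u∉C  | no w∉C  = trans (free UG u∉C w∉C) (sym (free UH u∉C w∉C))

module _ {n : ℕ} {G : Graph n} {C : Subset n} (U : StarUnion G C) where

  nonCentres-independent : Independent G (∁ C)
  nonCentres-independent u w u∈ w∈ = free U (x∈∁p⇒x∉p u∈) (x∈∁p⇒x∉p w∈)

  few-nonCentres⇒complete : ∣ ∁ C ∣ ≤ 1 → IsComplete G
  few-nonCentres⇒complete ∣∁C∣≤1 u w u≢w with u ∈? C | w ∈? C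
  ... | yes u∈C | _       = spoke U (inj₁ u∈C) u≢w
  ... | no _    | yes w∈C = spoke U (inj₂ w∈C) u≢w
  ... | no u∉C  | no w∉C  =
    contradiction ∣∁C∣≤1
      (<⇒≱ (two-members (x∉p⇒x∈∁p u∉C) (x∉p⇒x∈∁p w∉C) u≢w))

  independent-centre : ∀ {S c} → Independent G S → c ∈ C → c ∈ S → S ⊆ ⁅ c ⁆
  independent-centre {S} {c} S-ind c∈C c∈S {y} y∈S with y ≟F c
  ... | yes refl = x∈⁅x⁆ c
  ... | no  y≢c  = contradiction
    (trans (sym (spoke U (inj₁ c∈C) (y≢c ∘ sym))) (S-ind c y c∈S y∈S))
    (λ ())

  module _ (not-complete : ¬ IsComplete G) {S : Subset n}
           (S-max : MaxIndependent G S) where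

    -- A maximum independent set contains no centre, since a centre in it
    -- would leave room for at most one non-centre.
    maxIndependent-avoids-centres : S ⊆ ∁ C
    maxIndependent-avoids-centres {c} c∈S with c ∈? C
    ... | no  c∉C = x∉p⇒x∈∁p c∉C
    ... | yes c∈C = contradiction (few-nonCentres⇒complete ∣∁C∣≤1) not-complete
      where
      ∣∁C∣≤1 : ∣ ∁ C ∣ ≤ 1
      ∣∁C∣≤1 = ≤-trans (proj₂ S-max (∁ C) nonCentres-independent)
               (subst (∣ S ∣ ≤_) (∣⁅x⁆∣≡1 c)
                 (p⊆q⇒∣p∣≤∣q∣ (independent-centre (proj₁ S-max) c∈C c∈S)))

    maxIndependent-is-nonCentres : S ≡ ∁ C
    maxIndependent-is-nonCentres =
      ⊆-of-full-size maxIndependent-avoids-centres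
                     (proj₂ S-max (∁ C) nonCentres-independent)

mainTheorem5 : (n : ℕ) (G H : Graph n) (S : Subset n) →
               Astral G → ¬ IsComplete G →
               Astral H → ¬ IsComplete H →
               MaxIndependent G S → MaxIndependent H S →
               G ≈G H
mainTheorem5 n G H S astral-G G≠Kₙ astral-H H≠Kₙ S-max-G S-max-H
  with astral-starUnion astral-G | astral-starUnion astral-H
... | C , UG | D , UH = starUnion-unique UG (subst (StarUnion H) (sym C≡D) UH)
  where
  C≡D : C ≡ D
  C≡D = ∁-injective (trans (sym (maxIndependent-is-nonCentres UG G≠Kₙ S-max-G))
                           (maxIndependent-is-nonCentres UH H≠Kₙ S-max-H))
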